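{- Let $n\ge 6$. Then $n\,|\mathbf{A}(n)|\le 2L_n$, where $L_n=\sum_{\alpha\in\mathbf{A}(n)}|\mathrm{ap}(\alpha)|$.
   Context: Binary strings are compared lexicographically with $0<1$ (a proper prefix is smaller). For $\alpha=a_1\cdots a_n$, $\alpha^R=a_n\cdots a_1$. $[\alpha]$ is the set of rotations of $\alpha$; $\alpha$ is a necklace if it is lexicographically smallest in $[\alpha]$, and a bracelet if lexicographically smallest in $[\alpha]\cup[\alpha^R]$. A necklace $\alpha$ is symmetric if $\alpha^R\in[\alpha]$, otherwise asymmetric. $\mathbf{A}(n)$ is the set of length-$n$ asymmetric bracelets. The aperiodic prefix $\mathrm{ap}(\alpha)$ is the shortest string $\gamma$ with $\alpha=\gamma^t$ for some positive integer $t$. -}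

module Defs where

open import Data.Bool using (Bool; true; false)
open import Data.Nat using (ℕ; zero; suc; _+_; _*_; _<_; _≤_)
open import Data.List using (List; []; _∷_; _++_; length; take; drop; reverse; concat; replicate)
open import Data.List.Membership.Propositional using (_∈_)
open import Data.Sum using (_⊎_)
open import Data.Product using (∃; _×_)
open import Relation.Binary.PropositionalEquality using (_≡_; refl)
open import Relation.Nullary using (¬_; Dec; yes; no)
open import Data.List.Properties using (≡-dec)
import Data.Bool.Properties as BP

-- Binary strings over {0,1}, encoded as false = 0, true = 1.
Str : Set
Str = List Bool

_≟ₛ_ : (α β : Str) → Dec (α ≡ β)
_≟ₛ_ = ≡-dec BP._≟_

_≤ᵇ_ : Str → Str → Bool
[] ≤ᵇ β = true
(a ∷ α) ≤ᵇ [] = false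
(false ∷ α) ≤ᵇ (true ∷ β) = true
(true ∷ α) ≤ᵇ (false ∷ β) = false
(false ∷ α) ≤ᵇ (false ∷ β) = α ≤ᵇ β
(true ∷ α) ≤ᵇ (true ∷ β) = α ≤ᵇ β

_≤ₗ_ : Str → Str → Set
α ≤ₗ β = (α ≤ᵇ β) ≡ true

rotate : ℕ → Str → Str
rotate k α = drop k α ++ take k α

_∈Rot_ : Str → Str → Set
β ∈Rot α = ∃ λ k → k < length α × β ≡ rotate k α

IsNecklace : Str → Set
IsNecklace α = ∀ β → β ∈Rot α → α ≤ₗ β

IsBracelet : Str → Set
IsBracelet α = ∀ β → (β ∈Rot α ⊎ β ∈Rot reverse α) → α ≤ₗ β

IsAsymmetric : Str → Set
IsAsymmetric α = ¬ (reverse α ∈Rot α)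

IsPowerOf : Str → Str → Set
IsPowerOf α γ = ∃ λ t → 0 < t × α ≡ concat (replicate t γ)

IsAp : Str → Str → Set
IsAp α γ = IsPowerOf α γ × (∀ δ → IsPowerOf α δ → length γ ≤ length δ)

InA : ℕ → Str → Set
InA n α = length α ≡ n × IsBracelet α × IsAsymmetric α

-- Write d = |ap α| for α ∈ A(n).  Every α with 2d ≥ n contributes at least n to 2L_n,
-- and an aperiodic α (d = n) contributes 2n, i.e. n more than needed; so it suffices that
-- the "short" α (2d < n) are at most as many as the aperiodic ones, which an injection
-- shows.  A short α = γ^t has t ≥ 3 and γ asymmetric (a power of a symmetric string is
-- symmetric), so |γ| ≥ 6 because every binary string of length 1 to 5 is symmetric.
-- Hence n ≥ 2d + 6, and α can be sent to
--   0^m 1 0 (1 γ₁ 1 γ₂ ⋯ 1 γ_d) 1 1,   m = n − 2d − 4 ≥ 2.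
-- Past the run 0^m, this string and its reversal start with 1 and never contain 00.  So
-- every nontrivial rotation of either has a 1 among its first m symbols, except the
-- rotation 0^m 1 1 ⋯ of the reversal; this makes the image an aperiodic asymmetric bracelet.
module Submission where

open import Defs
open import Data.Bool using (true; false)
open import Data.Empty using (⊥-elim)
open import Data.List
  using (List; []; _∷_; _++_; length; take; drop; reverse; concat; replicate; map; filter)
open import Data.List.Properties
  using (length-++; length-replicate; length-reverse; length-drop; ++-identityʳ; ++-assoc;
         reverse-++; reverse-involutive; unfold-reverse; ++-cancelˡ; ++-cancelʳ;
         ∷-injectiveˡ; ∷-injectiveʳ; take++drop≡id; filter-accept; filter-reject;
         length-removeAt′)
open import Data.List.Membership.Propositional using (_∈_)
open import Data.List.Membership.Propositional.Properties
  using (∈-map⁺; ∈-++⁺ˡ; ∈-++⁺ʳ; ∈-filter⁺; ∈-filter⁻)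
open import Data.List.Relation.Unary.All as All using (All; all?)
open import Data.List.Relation.Unary.AllPairs using (_∷_)
open import Data.List.Relation.Unary.Any using (here; there; _─_; index)
open import Data.List.Relation.Unary.Unique.Propositional using (Unique)
import Data.List.Relation.Unary.Unique.Propositional.Properties as Unique
open import Data.Nat using (ℕ; zero; suc; _+_; _*_; _∸_; _≤_; _<_; z≤n; s≤s; _≟_; _≤?_; _<?_)
open import Data.Nat.ListAction using (sum)
open import Data.Nat.Properties
open import Algebra.Properties.CommutativeSemigroup +-commutativeSemigroup using (interchange)
open import Data.Product using (_,_; proj₁)
open import Data.Sum using (inj₁; inj₂)
open import Function.Bundles using (_⇔_; Equivalence)
open import Relation.Binary.Definitions using (tri<; tri≈; tri>)
open import Relation.Binary.PropositionalEquality
open import Relation.Nullary using (¬_; yes; no)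
open import Relation.Nullary.Decidable using (toWitness)
open import Relation.Unary using (Decidable)

private variable
  A B : Set

take-++ˡ : ∀ k (x y : List A) → k ≤ length x → take k (x ++ y) ≡ take k x
take-++ˡ zero    x       y _       = refl
take-++ˡ (suc k) (a ∷ x) y (s≤s p) = cong (a ∷_) (take-++ˡ k x y p)

drop-++ˡ : ∀ k (x y : List A) → k ≤ length x → drop k (x ++ y) ≡ drop k x ++ y
drop-++ˡ zero    x       y _       = refl
drop-++ˡ (suc k) (a ∷ x) y (s≤s p) = drop-++ˡ k x y p

take-++-≥ : ∀ k (x y : List A) → length x ≤ k → take k (x ++ y) ≡ x ++ take (k ∸ length x) y
take-++-≥ k       []      y _       = refl
take-++-≥ (suc k) (a ∷ x) y (s≤s p) = cong (a ∷_) (take-++-≥ k x y p)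

drop-++-≥ : ∀ k (x y : List A) → length x ≤ k → drop k (x ++ y) ≡ drop (k ∸ length x) y
drop-++-≥ k       []      y _       = refl
drop-++-≥ (suc k) (a ∷ x) y (s≤s p) = drop-++-≥ k x y p

take-length-++ : ∀ (x y : List A) → take (length x) (x ++ y) ≡ x
take-length-++ []      y = refl
take-length-++ (a ∷ x) y = cong (a ∷_) (take-length-++ x y)

drop-length-++ : ∀ (x y : List A) → drop (length x) (x ++ y) ≡ y
drop-length-++ []      y = refl
drop-length-++ (a ∷ x) y = drop-length-++ x y

drop-replicate : ∀ i m (a : A) → drop i (replicate m a) ≡ replicate (m ∸ i) a
drop-replicate zero    m       a = refl
drop-replicate (suc i) zero    a = refl
drop-replicate (suc i) (suc m) a = drop-replicate i m a

reverse-replicate : ∀ m (a : A) → reverse (replicate m a) ≡ replicate m a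
reverse-replicate zero    a = refl
reverse-replicate (suc m) a = begin
  reverse (a ∷ replicate m a)       ≡⟨ unfold-reverse a (replicate m a) ⟩
  reverse (replicate m a) ++ a ∷ [] ≡⟨ cong (_++ a ∷ []) (reverse-replicate m a) ⟩
  replicate m a ++ a ∷ []           ≡⟨ replicate-snoc m ⟩
  a ∷ replicate m a                 ∎
  where
  open ≡-Reasoning
  replicate-snoc : ∀ m → replicate m a ++ a ∷ [] ≡ a ∷ replicate m a
  replicate-snoc zero    = refl
  replicate-snoc (suc m) = cong (a ∷_) (replicate-snoc m)

∈-─ : ∀ {x y : A} {ys} (x∈ys : x ∈ ys) → y ∈ ys → y ≢ x → y ∈ (ys ─ x∈ys)
∈-─ (here refl) (here refl) y≢x = ⊥-elim (y≢x refl)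
∈-─ (here refl) (there y∈ys) _  = y∈ys
∈-─ (there x∈ys) (here refl) _  = here refl
∈-─ (there x∈ys) (there y∈ys) y≢x = there (∈-─ x∈ys y∈ys y≢x)

injection-length : ∀ {xs : List A} {ys : List B} {f : A → B} → Unique xs →
                   (∀ {x} → x ∈ xs → f x ∈ ys) →
                   (∀ {x y} → x ∈ xs → y ∈ xs → f x ≡ f y → x ≡ y) →
                   length xs ≤ length ys
injection-length {xs = []} _ _ _ = z≤n
injection-length {xs = x ∷ xs} {ys} {f} (x∉xs ∷ uniq) into inj = begin
  suc (length xs)            ≤⟨ s≤s (injection-length uniq into′ (λ p q → inj (there p) (there q))) ⟩
  suc (length (ys ─ fx∈ys))  ≡⟨ sym (length-removeAt′ ys (index fx∈ys)) ⟩
  length ys                  ∎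
  where
  open ≤-Reasoning
  fx∈ys : f x ∈ ys
  fx∈ys = into (here refl)
  into′ : ∀ {y} → y ∈ xs → f y ∈ (ys ─ fx∈ys)
  into′ y∈xs = ∈-─ fx∈ys (into (there y∈xs))
    (λ fy≡fx → All.lookup x∉xs y∈xs (inj (here refl) (there y∈xs) (sym fy≡fx)))

m∸n<m : ∀ {m n} → 0 < m → 0 < n → m ∸ n < m
m∸n<m {suc m} {suc n} _ _ = s≤s (m∸n≤m m n)

2*m<n*m⇒3≤n : ∀ {m} n → 2 * m < n * m → 3 ≤ n
2*m<n*m⇒3≤n     zero                ()
2*m<n*m⇒3≤n {m} (suc zero)          2m<m  = ⊥-elim (<⇒≱ 2m<m (+-monoʳ-≤ m z≤n))
2*m<n*m⇒3≤n     (suc (suc zero))    2m<2m = ⊥-elim (<-irrefl refl 2m<2m)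
2*m<n*m⇒3≤n     (suc (suc (suc _))) _     = s≤s (s≤s (s≤s z≤n))

+-interchange-≤ : ∀ a b c d {l r s u} → a + b ≤ 2 * c + d → l + r ≤ 2 * s + u →
                  (a + l) + (b + r) ≤ 2 * (c + s) + (d + u)
+-interchange-≤ a b c d {l} {r} {s} {u} p q = subst₂ _≤_
  (interchange a b l r)
  (trans (interchange (2 * c) d (2 * s) u) (cong (_+ (d + u)) (sym (*-distribˡ-+ 2 c s))))
  (+-mono-≤ p q)

n≤m⇒2m≮n : ∀ {n m} → n ≤ m → ¬ 2 * m < n
n≤m⇒2m≮n {m = m} n≤m 2m<n = <-irrefl refl (≤-trans (s≤s (≤-trans n≤m (m≤m+n m _))) 2m<n)

-- Per element: n ≤ 2 g unless 2 g < n, and n + n ≤ 2 g when n ≤ g.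
twice-sum-bound : ∀ (n : ℕ) (g : A → ℕ) xs →
  length xs * n + length (filter (λ x → n ≤? g x) xs) * n
    ≤ 2 * sum (map g xs) + length (filter (λ x → 2 * g x <? n) xs) * n
twice-sum-bound n g [] = z≤n
twice-sum-bound n g (x ∷ xs) with n ≤? g x | 2 * g x <? n
... | yes n≤g | yes 2g<n = ⊥-elim (n≤m⇒2m≮n n≤g 2g<n)
... | yes n≤g | no _
  rewrite filter-accept (λ x → n ≤? g x) {x} {xs} n≤g
        | filter-reject (λ x → 2 * g x <? n) {x} {xs} (n≤m⇒2m≮n n≤g)
  = +-interchange-≤ n n (g x) 0
      (≤-trans (+-mono-≤ n≤g (≤-trans n≤g (m≤m+n (g x) 0))) (m≤m+n _ 0))
      (twice-sum-bound n g xs)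
... | no _ | yes 2g<n
  rewrite filter-reject (λ x → n ≤? g x) {x} {xs} (λ n≤g → n≤m⇒2m≮n n≤g 2g<n)
        | filter-accept (λ x → 2 * g x <? n) {x} {xs} 2g<n
  = +-interchange-≤ n 0 (g x) n (≤-trans (≤-reflexive (+-identityʳ n)) (m≤n+m n _))
      (twice-sum-bound n g xs)
... | no n≰g | no 2g≮n
  rewrite filter-reject (λ x → n ≤? g x) {x} {xs} n≰g
        | filter-reject (λ x → 2 * g x <? n) {x} {xs} 2g≮n
  = +-interchange-≤ n 0 (g x) 0 (+-monoˡ-≤ 0 (≮⇒≥ 2g≮n)) (twice-sum-bound n g xs)

infixl 8 _^_
_^_ : Str → ℕ → Str
γ ^ t = concat (replicate t γ)

length-^ : ∀ γ t → length (γ ^ t) ≡ t * length γ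
length-^ γ zero    = refl
length-^ γ (suc t) = trans (length-++ γ) (cong (length γ +_) (length-^ γ t))

[]-^ : ∀ t → [] ^ t ≡ []
[]-^ zero    = refl
[]-^ (suc t) = []-^ t

^-++-comm : ∀ γ t → γ ^ t ++ γ ≡ γ ++ γ ^ t
^-++-comm γ zero    = sym (++-identityʳ γ)
^-++-comm γ (suc t) = trans (++-assoc γ (γ ^ t) γ) (cong (γ ++_) (^-++-comm γ t))

reverse-^ : ∀ γ t → reverse (γ ^ t) ≡ reverse γ ^ t
reverse-^ γ zero    = refl
reverse-^ γ (suc t) = begin
  reverse (γ ++ γ ^ t)            ≡⟨ reverse-++ γ (γ ^ t) ⟩
  reverse (γ ^ t) ++ reverse γ    ≡⟨ cong (_++ reverse γ) (reverse-^ γ t) ⟩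
  reverse γ ^ t ++ reverse γ      ≡⟨ ^-++-comm (reverse γ) t ⟩
  reverse γ ++ reverse γ ^ t      ∎
  where open ≡-Reasoning

^-shift : ∀ x y t → (x ++ y) ^ t ++ x ≡ x ++ (y ++ x) ^ t
^-shift x y zero    = sym (++-identityʳ x)
^-shift x y (suc t) = begin
  ((x ++ y) ++ (x ++ y) ^ t) ++ x ≡⟨ ++-assoc (x ++ y) _ x ⟩
  (x ++ y) ++ ((x ++ y) ^ t ++ x) ≡⟨ cong ((x ++ y) ++_) (^-shift x y t) ⟩
  (x ++ y) ++ (x ++ (y ++ x) ^ t) ≡⟨ ++-assoc x y _ ⟩
  x ++ (y ++ (x ++ (y ++ x) ^ t)) ≡⟨ cong (x ++_) (sym (++-assoc y x _)) ⟩
  x ++ ((y ++ x) ++ (y ++ x) ^ t) ∎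
  where open ≡-Reasoning

same-length-powers : ∀ {α β γ} → IsPowerOf α γ → IsPowerOf β γ → length α ≡ length β → α ≡ β
same-length-powers {γ = []} (t , _ , refl) (u , _ , refl) _ = trans ([]-^ t) (sym ([]-^ u))
same-length-powers {γ = c ∷ γ} (t , _ , refl) (u , _ , refl) |α|≡|β| =
  cong ((c ∷ γ) ^_) (*-cancelʳ-≡ t u (length (c ∷ γ))
    (trans (sym (length-^ (c ∷ γ) t)) (trans |α|≡|β| (length-^ (c ∷ γ) u))))

rotate-++ : ∀ x y → rotate (length x) (x ++ y) ≡ y ++ x
rotate-++ x y = cong₂ _++_ (drop-length-++ x y) (take-length-++ x y)

rotate-^ : ∀ γ t k → k ≤ length γ → rotate k (γ ^ suc t) ≡ rotate k γ ^ suc t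
rotate-^ γ t k k≤|γ| = begin
  drop k (γ ++ γ ^ t) ++ take k (γ ++ γ ^ t)
    ≡⟨ cong₂ _++_ (drop-++ˡ k γ (γ ^ t) k≤|γ|) (take-++ˡ k γ (γ ^ t) k≤|γ|) ⟩
  (y ++ γ ^ t) ++ x              ≡⟨ ++-assoc y _ x ⟩
  y ++ (γ ^ t ++ x)              ≡⟨ cong (λ z → y ++ (z ^ t ++ x)) (sym (take++drop≡id k γ)) ⟩
  y ++ ((x ++ y) ^ t ++ x)       ≡⟨ cong (y ++_) (^-shift x y t) ⟩
  y ++ (x ++ (y ++ x) ^ t)       ≡⟨ sym (++-assoc y x _) ⟩
  (y ++ x) ++ (y ++ x) ^ t       ∎
  where
  open ≡-Reasoning
  x = take k γ
  y = drop k γ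

rotate-^-period : ∀ δ t → rotate (length δ) (δ ^ suc t) ≡ δ ^ suc t
rotate-^-period δ t = trans (rotate-++ δ (δ ^ t)) (^-++-comm δ t)

reverse-rotate : ∀ k x → reverse (rotate k x) ≡ rotate (length x ∸ k) (reverse x)
reverse-rotate k x = begin
  reverse (drop k x ++ take k x)          ≡⟨ reverse-++ (drop k x) (take k x) ⟩
  reverse (take k x) ++ reverse (drop k x) ≡⟨ sym (rotate-++ (reverse (drop k x)) _) ⟩
  rotate (length (reverse (drop k x))) (reverse (drop k x) ++ reverse (take k x))
    ≡⟨ cong₂ rotate (trans (length-reverse (drop k x)) (length-drop k x))
                    (trans (sym (reverse-++ (take k x) (drop k x))) (cong reverse (take++drop≡id k x))) ⟩
  rotate (length x ∸ k) (reverse x)        ∎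
  where open ≡-Reasoning

rigid-aperiodic : ∀ {α δ} → (∀ k → 0 < k → k < length α → rotate k α ≢ α) →
                  IsPowerOf α δ → length α ≤ length δ
rigid-aperiodic {δ = δ} _ (suc zero , _ , refl) = ≤-reflexive (cong length (++-identityʳ δ))
rigid-aperiodic {δ = []} _ (suc (suc t) , _ , refl) = ≤-reflexive (cong length ([]-^ (suc (suc t))))
rigid-aperiodic {δ = c ∷ δ} rigid (suc (suc t) , _ , refl) =
  ⊥-elim (rigid (length (c ∷ δ)) (s≤s z≤n) shorter (rotate-^-period (c ∷ δ) (suc t)))
  where
  shorter : length (c ∷ δ) < length ((c ∷ δ) ^ suc (suc t))
  shorter = subst (length (c ∷ δ) <_) (sym (length-++ (c ∷ δ)))
                  (m<m+n (length (c ∷ δ)) (s≤s z≤n))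

-- Symmetric strings

IsSymmetric : Str → Set
IsSymmetric α = reverse α ∈Rot α

isSymmetric? : Decidable IsSymmetric
isSymmetric? α = anyUpTo? (λ k → reverse α ≟ₛ rotate k α) (length α)

symmetric-^ : ∀ γ t → IsSymmetric γ → IsSymmetric (γ ^ suc t)
symmetric-^ γ t (k , k<|γ| , reverse≡rotate) = k , k<|γ^t| , (begin
  reverse (γ ^ suc t)  ≡⟨ reverse-^ γ (suc t) ⟩
  reverse γ ^ suc t    ≡⟨ cong (_^ suc t) reverse≡rotate ⟩
  rotate k γ ^ suc t   ≡⟨ sym (rotate-^ γ t k (<⇒≤ k<|γ|)) ⟩
  rotate k (γ ^ suc t) ∎)
  where
  open ≡-Reasoning
  k<|γ^t| : k < length (γ ^ suc t)
  k<|γ^t| = ≤-trans k<|γ| (subst (length γ ≤_) (sym (length-++ γ)) (m≤m+n _ _))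

binaryStrings : ℕ → List Str
binaryStrings zero    = [] ∷ []
binaryStrings (suc k) = map (false ∷_) (binaryStrings k) ++ map (true ∷_) (binaryStrings k)

∈-binaryStrings : ∀ γ → γ ∈ binaryStrings (length γ)
∈-binaryStrings []          = here refl
∈-binaryStrings (false ∷ γ) = ∈-++⁺ˡ (∈-map⁺ (false ∷_) (∈-binaryStrings γ))
∈-binaryStrings (true ∷ γ)  = ∈-++⁺ʳ _ (∈-map⁺ (true ∷_) (∈-binaryStrings γ))

symmetric-binaryStrings : ∀ {k} → k < 5 → All IsSymmetric (binaryStrings (suc k))
symmetric-binaryStrings =
  toWitness {a? = allUpTo? (λ k → all? isSymmetric? (binaryStrings (suc k))) 5} _

symmetric-short : ∀ γ → 0 < length γ → length γ ≤ 5 → IsSymmetric γ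
symmetric-short (b ∷ γ) _ |bγ|≤5 =
  All.lookup (symmetric-binaryStrings |bγ|≤5) (∈-binaryStrings (b ∷ γ))

asymmetric-power-long : ∀ γ t → 0 < length γ → IsAsymmetric (γ ^ suc t) → 6 ≤ length γ
asymmetric-power-long γ t 0<|γ| asym with 6 ≤? length γ
... | yes 6≤|γ| = 6≤|γ|
... | no 6≰|γ|  = ⊥-elim (asym (symmetric-^ γ t (symmetric-short γ 0<|γ| (≤-pred (≰⇒> 6≰|γ|)))))

asymmetric-short-period : ∀ {α γ} → IsAsymmetric α → IsPowerOf α γ →
                          2 * length γ < length α → 2 * length γ + 6 ≤ length α
asymmetric-short-period {γ = []} _ (t , _ , refl) 0<|α| =
  ⊥-elim (<-irrefl refl (subst (0 <_) (cong length ([]-^ t)) 0<|α|))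
asymmetric-short-period {γ = γ@(_ ∷ _)} asym (suc t , _ , refl) 2d<|α| = begin
  2 * d + 6      ≤⟨ +-monoʳ-≤ (2 * d) (asymmetric-power-long γ t (s≤s z≤n) asym) ⟩
  2 * d + d      ≡⟨ trans (+-comm (2 * d) d) (*-comm 3 d) ⟩
  d * 3          ≤⟨ *-monoʳ-≤ d (2*m<n*m⇒3≤n (suc t) (subst (2 * d <_) (length-^ γ (suc t)) 2d<|α|)) ⟩
  d * suc t      ≡⟨ *-comm d (suc t) ⟩
  suc t * d      ≡⟨ sym (length-^ γ (suc t)) ⟩
  length (γ ^ suc t) ∎
  where
  open ≤-Reasoning
  d = length γ

-- Strings starting with a run of zeros

zeros : ℕ → Str
zeros m = replicate m false

data OneWithin : ℕ → Str → Set where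
  here  : ∀ {m x} → OneWithin (suc m) (true ∷ x)
  there : ∀ {m b x} → OneWithin m x → OneWithin (suc m) (b ∷ x)

oneWithin-weaken : ∀ {m m′ x} → m ≤ m′ → OneWithin m x → OneWithin m′ x
oneWithin-weaken (s≤s _) here      = here
oneWithin-weaken (s≤s p) (there o) = there (oneWithin-weaken p o)

oneWithin-++ : ∀ {m x} y → OneWithin m x → OneWithin m (x ++ y)
oneWithin-++ y here      = here
oneWithin-++ y (there o) = there (oneWithin-++ y o)

oneWithin-zeros : ∀ {j m} r → j < m → OneWithin m (zeros j ++ true ∷ r)
oneWithin-zeros {zero}  {suc m} r _       = here
oneWithin-zeros {suc j} {suc m} r (s≤s p) = there (oneWithin-zeros r p)

¬oneWithin-zeros : ∀ m r → ¬ OneWithin m (zeros m ++ r)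
¬oneWithin-zeros (suc m) r (there o) = ¬oneWithin-zeros m r o

≤ₗ-refl : ∀ x → x ≤ₗ x
≤ₗ-refl []          = refl
≤ₗ-refl (false ∷ x) = ≤ₗ-refl x
≤ₗ-refl (true ∷ x)  = ≤ₗ-refl x

zeros-one-≤ₗ : ∀ {m x} r → OneWithin m x → (zeros m ++ true ∷ r) ≤ₗ x
zeros-one-≤ₗ r here                        = refl
zeros-one-≤ₗ {x = false ∷ x} r (there o) = zeros-one-≤ₗ r o
zeros-one-≤ₗ {x = true ∷ x}  r (there o) = refl

zeros-10-≤ₗ-zeros-11 : ∀ m r s → (zeros m ++ true ∷ false ∷ r) ≤ₗ (zeros m ++ true ∷ true ∷ s)
zeros-10-≤ₗ-zeros-11 zero    r s = refl
zeros-10-≤ₗ-zeros-11 (suc m) r s = zeros-10-≤ₗ-zeros-11 m r s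

-- Nonempty concatenations of the blocks 1 and 01.
data Isolated : Str → Set where
  1∷[] : Isolated (true ∷ [])
  1∷_  : ∀ {x} → Isolated x → Isolated (true ∷ x)
  01∷_ : ∀ {x} → Isolated (true ∷ x) → Isolated (false ∷ true ∷ x)

isolated⇒oneWithin2 : ∀ {x} → Isolated x → OneWithin 2 x
isolated⇒oneWithin2 1∷[]     = here
isolated⇒oneWithin2 (1∷ _)   = here
isolated⇒oneWithin2 (01∷ _)  = there here

isolated-drop : ∀ {x} k → Isolated x → k < length x → Isolated (drop k x)
isolated-drop zero          iso            _               = iso
isolated-drop (suc k)       (1∷ iso)       (s≤s k<|x|)     = isolated-drop k iso k<|x|
isolated-drop (suc zero)    (01∷ iso)      _               = iso
isolated-drop (suc (suc k)) (01∷ (1∷ iso)) (s≤s (s≤s k<|x|)) = isolated-drop k iso k<|x|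
isolated-drop (suc k)       1∷[]           (s≤s ())
isolated-drop (suc (suc k)) (01∷ 1∷[])     (s≤s (s≤s ()))

oneWithin-drop : ∀ {m x} k → 2 ≤ m → Isolated x → k < length x → OneWithin m (drop k x)
oneWithin-drop k 2≤m iso k<|x| = oneWithin-weaken 2≤m (isolated⇒oneWithin2 (isolated-drop k iso k<|x|))

oneWithin-drop-zeros++ : ∀ {m w} i k → i ≤ m → 2 ≤ m → Isolated (true ∷ w) → 0 < k →
                        k < length (zeros i ++ true ∷ w) → OneWithin m (drop k (zeros i ++ true ∷ w))
oneWithin-drop-zeros++ zero    k             _   2≤m iso _ k<   = oneWithin-drop k 2≤m iso k<
oneWithin-drop-zeros++ (suc i) (suc zero)    i<m _   _   _ _    = oneWithin-zeros _ i<m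
oneWithin-drop-zeros++ (suc i) (suc (suc k)) i<m 2≤m iso _ (s≤s k<) =
  oneWithin-drop-zeros++ i (suc k) (<⇒≤ i<m) 2≤m iso (s≤s z≤n) k<

oneWithin-rotate-zeros++ : ∀ {m w} k → 2 ≤ m → Isolated (true ∷ w) → 0 < k →
                           k < length (zeros m ++ true ∷ w) → OneWithin m (rotate k (zeros m ++ true ∷ w))
oneWithin-rotate-zeros++ k 2≤m iso 0<k k< =
  oneWithin-++ _ (oneWithin-drop-zeros++ _ k ≤-refl 2≤m iso 0<k k<)

oneWithin-rotate-++zeros : ∀ {m w} k → 2 ≤ m → Isolated (true ∷ w) → k ≢ length (true ∷ w) →
                           OneWithin m (rotate k ((true ∷ w) ++ zeros m))
oneWithin-rotate-++zeros {m} {w} k 2≤m iso k≢|w| with <-cmp k (length (true ∷ w))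
... | tri< k<|w| _ _ = oneWithin-++ _ (subst (OneWithin m) (sym (drop-++ˡ k (true ∷ w) (zeros m) (<⇒≤ k<|w|)))
                         (oneWithin-++ _ (oneWithin-drop k 2≤m iso k<|w|)))
... | tri≈ _ k≡|w| _ = ⊥-elim (k≢|w| k≡|w|)
... | tri> _ _ k>|w| = subst (OneWithin m) (sym rotation)
                         (oneWithin-zeros _ (m∸n<m (≤-trans (s≤s z≤n) 2≤m) (m<n⇒0<n∸m k>|w|)))
  where
  j = k ∸ length (true ∷ w)
  rotation : rotate k ((true ∷ w) ++ zeros m) ≡ zeros (m ∸ j) ++ (true ∷ w) ++ take j (zeros m)
  rotation = cong₂ _++_ (trans (drop-++-≥ k (true ∷ w) (zeros m) (<⇒≤ k>|w|)) (drop-replicate j m false))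
                        (take-++-≥ k (true ∷ w) (zeros m) (<⇒≤ k>|w|))

-- The embedding of short periods

onesBefore : Str → Str
onesBefore []      = []
onesBefore (b ∷ γ) = true ∷ b ∷ onesBefore γ

onesAfter : Str → Str
onesAfter []      = []
onesAfter (b ∷ γ) = b ∷ true ∷ onesAfter γ

body : Str → Str
body γ = true ∷ false ∷ onesBefore γ ++ true ∷ true ∷ []

mirror : Str → Str
mirror γ = true ∷ true ∷ onesAfter (reverse γ) ++ false ∷ true ∷ []

embed : ℕ → Str → Str
embed m γ = zeros m ++ body γ

onesBefore-injective : ∀ γ γ′ → onesBefore γ ≡ onesBefore γ′ → γ ≡ γ′
onesBefore-injective []      []       _  = refl
onesBefore-injective (b ∷ γ) (b′ ∷ γ′) eq =
  cong₂ _∷_ (∷-injectiveˡ (∷-injectiveʳ eq)) (onesBefore-injective γ γ′ (∷-injectiveʳ (∷-injectiveʳ eq)))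

length-onesBefore : ∀ γ → length (onesBefore γ) ≡ 2 * length γ
length-onesBefore []      = refl
length-onesBefore (b ∷ γ) = trans (cong (2 +_) (length-onesBefore γ)) (sym (*-suc 2 (length γ)))

onesAfter-++ : ∀ x y → onesAfter (x ++ y) ≡ onesAfter x ++ onesAfter y
onesAfter-++ []      y = refl
onesAfter-++ (b ∷ x) y = cong (λ z → b ∷ true ∷ z) (onesAfter-++ x y)

reverse-onesBefore : ∀ γ → reverse (onesBefore γ) ≡ onesAfter (reverse γ)
reverse-onesBefore []      = refl
reverse-onesBefore (b ∷ γ) = begin
  reverse (true ∷ b ∷ [] ++ onesBefore γ)          ≡⟨ reverse-++ (true ∷ b ∷ []) (onesBefore γ) ⟩
  reverse (onesBefore γ) ++ b ∷ true ∷ []           ≡⟨ cong (_++ b ∷ true ∷ []) (reverse-onesBefore γ) ⟩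
  onesAfter (reverse γ) ++ onesAfter (b ∷ [])       ≡⟨ sym (onesAfter-++ (reverse γ) (b ∷ [])) ⟩
  onesAfter (reverse γ ++ b ∷ [])                   ≡⟨ cong onesAfter (sym (unfold-reverse b γ)) ⟩
  onesAfter (reverse (b ∷ γ))                       ∎
  where open ≡-Reasoning

reverse-body : ∀ γ → reverse (body γ) ≡ mirror γ
reverse-body γ = begin
  reverse (true ∷ false ∷ [] ++ onesBefore γ ++ true ∷ true ∷ [])
    ≡⟨ reverse-++ (true ∷ false ∷ []) (onesBefore γ ++ true ∷ true ∷ []) ⟩
  reverse (onesBefore γ ++ true ∷ true ∷ []) ++ false ∷ true ∷ []
    ≡⟨ cong (_++ false ∷ true ∷ []) (reverse-++ (onesBefore γ) (true ∷ true ∷ [])) ⟩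
  (true ∷ true ∷ reverse (onesBefore γ)) ++ false ∷ true ∷ []
    ≡⟨ cong (λ z → (true ∷ true ∷ z) ++ false ∷ true ∷ []) (reverse-onesBefore γ) ⟩
  mirror γ ∎
  where open ≡-Reasoning

reverse-embed : ∀ m γ → reverse (embed m γ) ≡ mirror γ ++ zeros m
reverse-embed m γ = trans (reverse-++ (zeros m) (body γ))
                          (cong₂ _++_ (reverse-body γ) (reverse-replicate m false))

length-embed : ∀ m γ → length (embed m γ) ≡ m + (2 * length γ + 4)
length-embed m γ = begin
  length (zeros m ++ body γ)                        ≡⟨ length-++ (zeros m) ⟩
  length (zeros m) + (2 + length (onesBefore γ ++ true ∷ true ∷ []))
    ≡⟨ cong₂ (λ a b → a + (2 + b)) (length-replicate m) (length-++ (onesBefore γ)) ⟩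
  m + (2 + (length (onesBefore γ) + 2))            ≡⟨ cong (λ b → m + (2 + (b + 2))) (length-onesBefore γ) ⟩
  m + (2 + (2 * length γ + 2))                      ≡⟨ cong (m +_) (trans (+-comm 2 _) (+-assoc (2 * length γ) 2 2)) ⟩
  m + (2 * length γ + 4)                            ∎
  where open ≡-Reasoning

embed-injective : ∀ m m′ γ γ′ → embed m γ ≡ embed m′ γ′ → γ ≡ γ′
embed-injective zero    zero     γ γ′ eq = onesBefore-injective γ γ′
  (++-cancelʳ (true ∷ true ∷ []) (onesBefore γ) (onesBefore γ′) (∷-injectiveʳ (∷-injectiveʳ eq)))
embed-injective (suc m) (suc m′) γ γ′ eq = embed-injective m m′ γ γ′ (∷-injectiveʳ eq)
embed-injective zero    (suc m′) γ γ′ eq with () ← ∷-injectiveˡ eq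
embed-injective (suc m) zero     γ γ′ eq with () ← ∷-injectiveˡ eq

isolated-body : ∀ γ → Isolated (body γ)
isolated-body γ = go false γ
  where
  prepend : ∀ b {x} → Isolated (true ∷ x) → Isolated (true ∷ b ∷ true ∷ x)
  prepend true  iso = 1∷ 1∷ iso
  prepend false iso = 1∷ 01∷ iso
  go : ∀ b γ → Isolated (true ∷ b ∷ onesBefore γ ++ true ∷ true ∷ [])
  go b []      = prepend b (1∷ 1∷[])
  go b (c ∷ γ) = prepend b (go c γ)

isolated-mirror : ∀ γ → Isolated (mirror γ)
isolated-mirror γ = 1∷ 1∷ go (reverse γ)
  where
  go : ∀ δ → Isolated (onesAfter δ ++ false ∷ true ∷ [])
  go []          = 01∷ 1∷[]
  go (true ∷ δ)  = 1∷ 1∷ go δ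
  go (false ∷ δ) = 01∷ 1∷ go δ

module _ {m : ℕ} (2≤m : 2 ≤ m) (γ : Str) where

  embed-rigid : ∀ k → 0 < k → k < length (embed m γ) → rotate k (embed m γ) ≢ embed m γ
  embed-rigid k 0<k k< rotation≡ = ¬oneWithin-zeros m (body γ)
    (subst (OneWithin m) rotation≡ (oneWithin-rotate-zeros++ k 2≤m (isolated-body γ) 0<k k<))

  embed-bracelet : IsBracelet (embed m γ)
  embed-bracelet _ (inj₁ (zero , _ , refl)) =
    subst (embed m γ ≤ₗ_) (sym (++-identityʳ (embed m γ))) (≤ₗ-refl (embed m γ))
  embed-bracelet _ (inj₁ (suc k , k< , refl)) =
    zeros-one-≤ₗ _ (oneWithin-rotate-zeros++ (suc k) 2≤m (isolated-body γ) (s≤s z≤n) k<)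
  embed-bracelet _ (inj₂ (k , _ , refl)) rewrite reverse-embed m γ with k ≟ length (mirror γ)
  ... | yes refl = subst (embed m γ ≤ₗ_) (sym (rotate-++ (mirror γ) (zeros m)))
                         (zeros-10-≤ₗ-zeros-11 m _ _)
  ... | no k≢   = zeros-one-≤ₗ _ (oneWithin-rotate-++zeros k 2≤m (isolated-mirror γ) k≢)

  embed-≢-rotate-mirror : ∀ j → embed m γ ≢ rotate j (mirror γ ++ zeros m)
  embed-≢-rotate-mirror j eq with j ≟ length (mirror γ)
  ... | yes refl with () ← ∷-injectiveˡ (∷-injectiveʳ (++-cancelˡ (zeros m) (body γ) (mirror γ)
                                          (trans eq (rotate-++ (mirror γ) (zeros m)))))
  ... | no j≢ = ¬oneWithin-zeros m (body γ)
                  (subst (OneWithin m) (sym eq) (oneWithin-rotate-++zeros j 2≤m (isolated-mirror γ) j≢))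

  embed-asymmetric : IsAsymmetric (embed m γ)
  embed-asymmetric (k , _ , reverse≡) = embed-≢-rotate-mirror (length (embed m γ) ∸ k) (begin
    embed m γ                                          ≡⟨ sym (reverse-involutive (embed m γ)) ⟩
    reverse (reverse (embed m γ))                      ≡⟨ cong reverse reverse≡ ⟩
    reverse (rotate k (embed m γ))                     ≡⟨ reverse-rotate k (embed m γ) ⟩
    rotate (length (embed m γ) ∸ k) (reverse (embed m γ)) ≡⟨ cong (rotate (length (embed m γ) ∸ k)) (reverse-embed m γ) ⟩
    rotate (length (embed m γ) ∸ k) (mirror γ ++ zeros m) ∎)
    where open ≡-Reasoning

code : ℕ → Str → Str
code n γ = embed (n ∸ (2 * length γ + 4)) γ

module _ {n : ℕ} {γ : Str} (room : 2 * length γ + 6 ≤ n) where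

  private
    2≤m : 2 ≤ n ∸ (2 * length γ + 4)
    2≤m = subst (_≤ n ∸ (2 * length γ + 4)) (m+n∸m≡n (2 * length γ + 4) 2)
            (∸-monoˡ-≤ (2 * length γ + 4) (subst (_≤ n) (sym (+-assoc (2 * length γ) 4 2)) room))

  length-code : length (code n γ) ≡ n
  length-code = trans (length-embed (n ∸ (2 * length γ + 4)) γ) (trans (+-comm _ (2 * length γ + 4))
                  (m+[n∸m]≡n (≤-trans (+-monoʳ-≤ (2 * length γ) (m≤m+n 4 2)) room)))

  code-∈A : InA n (code n γ)
  code-∈A = length-code , embed-bracelet 2≤m γ , embed-asymmetric 2≤m γ

  code-aperiodic : ∀ {δ} → IsPowerOf (code n γ) δ → n ≤ length δ
  code-aperiodic power = subst (_≤ _) length-code (rigid-aperiodic (embed-rigid 2≤m γ) power)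

module Census (n : ℕ) (as : List Str) (isA : ∀ α → (α ∈ as) ⇔ InA n α)
              (ap : Str → Str) (isAp : All (λ α → IsAp α (ap α)) as) where

  short? : Decidable (λ α → 2 * length (ap α) < n)
  short? α = 2 * length (ap α) <? n

  full? : Decidable (λ α → n ≤ length (ap α))
  full? α = n ≤? length (ap α)

  private
    power : ∀ {α} → α ∈ as → IsPowerOf α (ap α)
    power α∈as = proj₁ (All.lookup isAp α∈as)

    length≡n : ∀ {α} → α ∈ as → length α ≡ n
    length≡n α∈as = proj₁ (Equivalence.to (isA _) α∈as)

    room : ∀ {α} → α ∈ filter short? as → 2 * length (ap α) + 6 ≤ n
    room α∈ =
      let (α∈as , short) = ∈-filter⁻ short? α∈
          (_ , _ , asym) = Equivalence.to (isA _) α∈as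
      in subst (_ ≤_) (length≡n α∈as)
           (asymmetric-short-period asym (power α∈as) (subst (_ <_) (sym (length≡n α∈as)) short))

  code-full : ∀ {α} → α ∈ filter short? as → code n (ap α) ∈ filter full? as
  code-full {α} α∈ = ∈-filter⁺ full? c∈as (code-aperiodic (room α∈) (power c∈as))
    where
    c∈as : code n (ap α) ∈ as
    c∈as = Equivalence.from (isA _) (code-∈A (room α∈))

  code-injective : ∀ {α β} → α ∈ filter short? as → β ∈ filter short? as →
                   code n (ap α) ≡ code n (ap β) → α ≡ β
  code-injective {α} {β} α∈ β∈ eq =
    same-length-powers (power α∈as) (subst (IsPowerOf β) (sym ap≡) (power β∈as))
                       (trans (length≡n α∈as) (sym (length≡n β∈as)))
    where
    α∈as : α ∈ as
    α∈as = proj₁ (∈-filter⁻ short? α∈)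
    β∈as : β ∈ as
    β∈as = proj₁ (∈-filter⁻ short? β∈)
    ap≡ : ap α ≡ ap β
    ap≡ = embed-injective _ _ _ _ eq

corollary2 : (n : ℕ) → 6 ≤ n → (as : List Str) → Unique as →
    (∀ α → (α ∈ as) ⇔ InA n α) →
    (ap : Str → Str) → All (λ α → IsAp α (ap α)) as →
    n * length as ≤ 2 * sum (map (λ α → length (ap α)) as)
corollary2 n _ as unique isA ap isAp = begin
  n * length as      ≡⟨ *-comm n (length as) ⟩
  length as * n      ≤⟨ +-cancelʳ-≤ (length full * n) _ _ (begin
    length as * n + length full * n       ≤⟨ twice-sum-bound n g as ⟩
    2 * sum (map g as) + length short * n ≤⟨ +-monoʳ-≤ (2 * sum (map g as)) (*-monoˡ-≤ n short≤full) ⟩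
    2 * sum (map g as) + length full * n  ∎) ⟩
  2 * sum (map g as) ∎
  where
  open ≤-Reasoning
  open Census n as isA ap isAp
  g : Str → ℕ
  g α = length (ap α)
  short full : List Str
  short = filter short? as
  full  = filter full? as
  short≤full : length short ≤ length full
  short≤full = injection-length (Unique.filter⁺ short? unique) code-full code-injective
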